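{- Let $r\geq2$ and $n\ge0$. The map $T$ defined on $\mathcal{A}''_r(n)$ by $T(\lambda)=\lambda$ for $\lambda\in\mathcal{A}_{r-1,r-1}(n)$, and for $\lambda\in\mathcal{A}'_r(n)$ (with Durfee square sides $n_1\ge\dots\ge n_{r-1}$, $M=M_\lambda$, $N=n_1+\dots+n_{M-1}$) $$T(\lambda)=(\lambda_1,\dots,\lambda_N,\ \lambda_{N+1}-1,\dots,\lambda_{N+n_M}-1,\ n_M,\ \lambda_{N+n_M+1},\dots,\lambda_{s}),$$ takes values in $\mathcal{A}_{r,r-1}(n)$ and is a bijection from $\mathcal{A}''_r(n)$ onto $\mathcal{A}_{r,r-1}(n)$.
   Context: A partition $\lambda=(\lambda_1,\dots,\lambda_s)$ is a non-increasing finite sequence of positive integers. For a (possibly empty) partition $\mu=(\mu_1,\dots,\mu_t)$ let $\mathrm{sq}(\mu)=\max\{d\ge0:d\le t,\ \mu_d\ge d\}$ and, for nonempty $\mu$, $\mathrm{vrect}(\mu)=\max\{k\ge1:k\le t,\ \mu_k\ge k-1\}$ (the vertical Durfee rectangle has $k$ rows and $k-1$ columns), $\mathrm{vrect}(\emptyset)=0$. The successive Durfee squares of $\lambda$: $\mu^{(0)}=\lambda$, $n_j=\mathrm{sq}(\mu^{(j-1)})$, $\mu^{(j)}$ is $\mu^{(j-1)}$ with its first $n_j$ parts deleted. $\mathcal{A}_{r-1,r-1}(n)$: partitions of $n$ with $\mu^{(r-2)}$ empty (at most $r-2$ non-empty successive Durfee squares). $\mathcal{A}'_r(n)$: partitions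 of $n$ with exactly $r-1$ non-empty successive Durfee squares (i.e. $n_1,\dots,n_{r-1}\ge1$ and $n_1+\dots+n_{r-1}=s$) such that $A_\lambda\ne\emptyset$, where $A_\lambda=\{1\le j\le r-1:\ \lambda_{n_1+\dots+n_j}>n_j\}$; then $M_\lambda=\max A_\lambda$. $\mathcal{A}''_r(n)=\mathcal{A}_{r-1,r-1}(n)\sqcup\mathcal{A}'_r(n)$. $\mathcal{A}_{r,r-1}(n)$: partitions $\lambda$ of $n$ such that, with $\rho^{(0)}=\lambda$, $\rho^{(j)}$ equal to $\rho^{(j-1)}$ with its first $\mathrm{sq}(\rho^{(j-1)})$ parts deleted for $1\le j\le r-2$, and $\rho^{(r-1)}$ equal to $\rho^{(r-2)}$ with its first $k=\mathrm{vrect}(\rho^{(r-2)})$ parts deleted, $\rho^{(r-1)}$ is empty and, if $\rho^{(r-2)}$ is nonempty, its $k$-th part equals $k-1$. -}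

module Defs where

open import Data.Nat using (ℕ; zero; suc; _+_; _∸_; _≤_; _<_; _≤?_; _<?_; pred)
open import Data.Bool using (Bool; true; false; if_then_else_)
open import Data.List using (List; []; _∷_; length; take; drop; map; _++_)
open import Data.Nat.ListAction using (sum)
open import Data.List.Relation.Unary.All using (All)
open import Data.List.Relation.Unary.Linked using (Linked)
open import Data.Product using (_×_; ∃)
open import Relation.Binary.PropositionalEquality using (_≡_)
open import Relation.Nullary using (¬_)
open import Relation.Nullary.Decidable using (⌊_⌋)

IsPartition : List ℕ → Set
IsPartition p = Linked (λ a b → b ≤ a) p × All (λ a → 0 < a) p

PartitionOf : ℕ → List ℕ → Set
PartitionOf n p = IsPartition p × sum p ≡ n

-- 1-indexed entry (default 0 outside the range)
nth : List ℕ → ℕ → ℕ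
nth []       _             = 0
nth (x ∷ xs) zero          = 0
nth (x ∷ xs) (suc zero)    = x
nth (x ∷ xs) (suc (suc i)) = nth xs (suc i)

-- largest d with 0 ≤ d ≤ t and P d (0 if none among 1..t)
maxSat : (ℕ → Bool) → ℕ → ℕ
maxSat P zero    = 0
maxSat P (suc t) = if P (suc t) then suc t else maxSat P t

sq : List ℕ → ℕ
sq μ = maxSat (λ d → ⌊ d ≤? nth μ d ⌋) (length μ)

vrect : List ℕ → ℕ
vrect μ = maxSat (λ k → ⌊ pred k ≤? nth μ k ⌋) (length μ)

-- μ^(j): delete successive Durfee squares j times
residual : ℕ → List ℕ → List ℕ
residual zero    μ = μ
residual (suc j) μ = residual j (drop (sq μ) μ)

sides : ℕ → List ℕ → List ℕ
sides zero    μ = []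
sides (suc j) μ = sq μ ∷ sides j (drop (sq μ) μ)

side : ℕ → List ℕ → ℕ → ℕ
side r p j = nth (sides (r ∸ 1) p) j

psum : ℕ → List ℕ → ℕ → ℕ
psum r p j = sum (take j (sides (r ∸ 1) p))

A-rm1 : ℕ → ℕ → List ℕ → Set
A-rm1 r n p = PartitionOf n p × residual (r ∸ 2) p ≡ []

InA : ℕ → List ℕ → ℕ → Set
InA r p j = 1 ≤ j × j ≤ r ∸ 1 × side r p j < nth p (psum r p j)

A' : ℕ → ℕ → List ℕ → Set
A' r n p = PartitionOf n p
         × (∀ j → 1 ≤ j → j ≤ r ∸ 1 → 1 ≤ side r p j)
         × psum r p (r ∸ 1) ≡ length p
         × ∃ (λ j → InA r p j)

A'' : ℕ → ℕ → List ℕ → Set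
A'' r n p = A-rm1 r n p Data.Sum.⊎ A' r n p
  where import Data.Sum

Mλ : ℕ → List ℕ → ℕ
Mλ r p = maxSat (λ j → ⌊ side r p j <? nth p (psum r p j) ⌋) (r ∸ 1)

T' : ℕ → List ℕ → List ℕ
T' r p = take N p ++ map pred (take nM (drop N p)) ++ (nM ∷ drop (N + nM) p)
  where
    M  = Mλ r p
    N  = psum r p (M ∸ 1)
    nM = side r p M

isEmpty : List ℕ → Bool
isEmpty [] = true
isEmpty (_ ∷ _) = false

T : ℕ → List ℕ → List ℕ
T r p = if isEmpty (residual (r ∸ 2) p) then p else T' r p

A-rr1 : ℕ → ℕ → List ℕ → Set
A-rr1 r n p = PartitionOf n p
            × drop (vrect ρ) ρ ≡ []
            × (¬ (ρ ≡ []) → nth ρ (vrect ρ) ≡ vrect ρ ∸ 1)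
  where ρ = residual (r ∸ 2) p

-- Cut λ into its successive Durfee squares B₁, …, B_{r−1}.  Block j is raised when its last part exceeds its
-- side nⱼ, which is exactly j ∈ A_λ; so B_M is the last raised block and every later block is tight, ending in
-- a part equal to its side.  T lowers the parts of B_M by one and inserts n_M after them: the lowered block is
-- still a Durfee square, and each later tight block C′ ++ [|C|] turns into the square (previous side) ∷ C′.
-- Hence the first r − 2 squares of T λ leave X ++ [|X|], the vertical rectangle shape of A_{r,r−1}, while on
-- A_{r−1,r−1} the map is the identity and leaves nothing.  Conversely, such a remainder can be undone square
-- by square from the back, and the lowered list determines where the marked block was.

module Submission where

open import Defs
open import Data.Nat using (ℕ; zero; suc; _+_; _∸_; _≤_; _<_; _≥_; _≤?_; _<?_; pred; z≤n; s≤s; s≤s⁻¹)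
open import Data.Nat.Properties
open import Data.Bool using (Bool; true; false; if_then_else_)
open import Data.List using (List; []; _∷_; _∷ʳ_; initLast; _∷ʳ′_; length; take; drop; map; foldr; _++_)
open import Data.List.Properties
  using (length-++; length-++-≤ˡ; length-map; length-drop; map-++; ++-assoc; ++-conicalʳ; ∷-injectiveˡ; ∷-injectiveʳ; ∷ʳ-++;
         foldr-++; take-all; drop-all; drop-drop)
open import Data.Nat.ListAction using (sum)
open import Data.Nat.ListAction.Properties using (sum-++)
open import Data.List.Relation.Unary.All using (All; []; _∷_)
import Data.List.Relation.Unary.All as All
import Data.List.Relation.Unary.All.Properties as Allₚ
open import Data.List.Relation.Unary.Any using (Any; here; there; any?)
import Data.List.Relation.Unary.Any.Properties as Anyₚ
open import Data.List.Relation.Unary.AllPairs using (AllPairs; []; _∷_)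
import Data.List.Relation.Unary.AllPairs as AllPairs
import Data.List.Relation.Unary.AllPairs.Properties as AllPairsₚ
open import Data.List.Relation.Unary.Linked using (Linked)
open import Data.List.Relation.Unary.Linked.Properties using (Linked⇒AllPairs; AllPairs⇒Linked)
open import Data.Product using (_×_; _,_; ∃; ∃₂; proj₁; proj₂)
open import Data.Sum using (inj₁; inj₂)
open import Function using (_∘_; case_of_)
open import Relation.Binary.PropositionalEquality
open import Relation.Nullary using (¬_; Dec; yes; no; contradiction)
open import Relation.Nullary.Decidable using (⌊_⌋)
open import Relation.Unary using (Decidable)

private
  variable
    A : Set

⌊⌋-true : {P : Set} (p? : Dec P) → P → ⌊ p? ⌋ ≡ true
⌊⌋-true (yes _) _ = refl
⌊⌋-true (no ¬p) p = contradiction p ¬p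

⌊⌋-false : {P : Set} (p? : Dec P) → ¬ P → ⌊ p? ⌋ ≡ false
⌊⌋-false (yes p) ¬p = contradiction p ¬p
⌊⌋-false (no _)  _  = refl

⌊⌋-true⁻¹ : {P : Set} (p? : Dec P) → ⌊ p? ⌋ ≡ true → P
⌊⌋-true⁻¹ (yes p) _ = p

split-last : {P : A → Set} → Decidable P → ∀ {xs} → Any P xs →
  ∃ λ pre → ∃ λ x → ∃ λ post → xs ≡ pre ++ x ∷ post × P x × All (¬_ ∘ P) post
split-last P? {x ∷ xs} px∷xs with any? P? xs
... | yes pxs with split-last P? pxs
...   | pre , y , post , refl , py , ¬post = x ∷ pre , y , post , refl , py , ¬post
split-last P? {x ∷ xs} px∷xs | no ¬pxs = [] , x , xs , refl , px , Allₚ.¬Any⇒All¬ xs ¬pxs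
  where
  px = case px∷xs of λ { (here px) → px ; (there pxs) → contradiction pxs ¬pxs }

split-at : (xs : List A) (i : ℕ) → i < length xs →
  ∃ λ pre → ∃ λ x → ∃ λ post → xs ≡ pre ++ x ∷ post × length pre ≡ i
split-at (x ∷ xs) zero    _         = [] , x , xs , refl , refl
split-at (x ∷ xs) (suc i) (s≤s i<n) with split-at xs i i<n
... | pre , y , post , refl , refl = x ∷ pre , y , post , refl , refl

length-++-∷ : (xs : List A) (y : A) (ys : List A) → length (xs ++ y ∷ ys) ≡ suc (length xs + length ys)
length-++-∷ xs y ys = trans (length-++ xs) (+-suc (length xs) (length ys))

length-∷ʳ : (xs : List A) (x : A) → length (xs ∷ʳ x) ≡ suc (length xs)
length-∷ʳ xs x = trans (length-++ xs) (+-comm (length xs) 1)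

take-++-length : (xs ys : List A) → take (length xs) (xs ++ ys) ≡ xs
take-++-length []       ys = refl
take-++-length (x ∷ xs) ys = cong (x ∷_) (take-++-length xs ys)

drop-++-length : (xs ys : List A) → drop (length xs) (xs ++ ys) ≡ ys
drop-++-length []       ys = refl
drop-++-length (x ∷ xs) ys = drop-++-length xs ys

take-length-++ : ∀ (xs ys : List A) n → take (length xs + n) (xs ++ ys) ≡ xs ++ take n ys
take-length-++ []       ys n = refl
take-length-++ (x ∷ xs) ys n = cong (x ∷_) (take-length-++ xs ys n)

drop-length-++ : ∀ (xs ys : List A) n → drop (length xs + n) (xs ++ ys) ≡ drop n ys
drop-length-++ []       ys n = refl
drop-length-++ (x ∷ xs) ys n = drop-length-++ xs ys n

++-cancel-length : ∀ (xs xs′ : List A) {ys ys′} → length xs ≡ length xs′ → xs ++ ys ≡ xs′ ++ ys′ →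
                   xs ≡ xs′ × ys ≡ ys′
++-cancel-length xs xs′ {ys} {ys′} |xs|≡ eq =
  trans (sym (take-++-length xs ys)) (trans (cong₂ take |xs|≡ eq) (take-++-length xs′ ys′)) ,
  trans (sym (drop-++-length xs ys)) (trans (cong₂ drop |xs|≡ eq) (drop-++-length xs′ ys′))

map-pred-injective : ∀ {B B′} → All (0 <_) B → All (0 <_) B′ → map pred B ≡ map pred B′ → B ≡ B′
map-pred-injective []             []              _  = refl
map-pred-injective (s≤s _ ∷ B>0) (s≤s _ ∷ B′>0) eq =
  cong₂ _∷_ (cong suc (∷-injectiveˡ eq)) (map-pred-injective B>0 B′>0 (∷-injectiveʳ eq))

map-pred-suc : ∀ X → map pred (map suc X) ≡ X
map-pred-suc []      = refl
map-pred-suc (x ∷ X) = cong (x ∷_) (map-pred-suc X)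

nth-∷ : ∀ x xs i → 1 ≤ i → nth (x ∷ xs) (suc i) ≡ nth xs i
nth-∷ x xs (suc i) _ = refl

nth-++ˡ : ∀ xs ys i → suc i ≤ length xs → nth (xs ++ ys) (suc i) ≡ nth xs (suc i)
nth-++ˡ (x ∷ xs) ys zero    _         = refl
nth-++ˡ (x ∷ xs) ys (suc i) (s≤s i<n) = nth-++ˡ xs ys i i<n

nth-++ʳ : ∀ xs ys i → 1 ≤ i → nth (xs ++ ys) (length xs + i) ≡ nth ys i
nth-++ʳ []       ys i _   = refl
nth-++ʳ (x ∷ xs) ys i 1≤i =
  trans (nth-∷ x (xs ++ ys) (length xs + i) (≤-trans 1≤i (m≤n+m i (length xs)))) (nth-++ʳ xs ys i 1≤i)

nth-middle : ∀ xs x ys → nth (xs ++ x ∷ ys) (suc (length xs)) ≡ x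
nth-middle xs x ys = trans (cong (nth (xs ++ x ∷ ys)) (+-comm 1 (length xs))) (nth-++ʳ xs (x ∷ ys) 1 ≤-refl)

nth-last : ∀ xs x → nth (xs ∷ʳ x) (suc (length xs)) ≡ x
nth-last xs x = nth-middle xs x []

nth-≤ : ∀ {d xs} → All (_≤ d) xs → ∀ i → nth xs i ≤ d
nth-≤ []         i             = z≤n
nth-≤ (_ ∷ _)    zero          = z≤n
nth-≤ (x≤d ∷ _)  (suc zero)    = x≤d
nth-≤ (_ ∷ xs≤d) (suc (suc i)) = nth-≤ xs≤d (suc i)

nth-≥ : ∀ {d xs} → All (d ≤_) xs → ∀ i → 1 ≤ i → i ≤ length xs → d ≤ nth xs i
nth-≥ (d≤x ∷ _)  (suc zero)    _ _         = d≤x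
nth-≥ (_ ∷ d≤xs) (suc (suc i)) _ (s≤s i≤n) = nth-≥ d≤xs (suc i) (s≤s z≤n) i≤n

nth-beyond : ∀ {d} xs ys i → All (_≤ d) ys → length xs < i → nth (xs ++ ys) i ≤ d
nth-beyond {d} xs ys i ys≤d n<i =
  let o , i≡ = m≤n⇒∃[o]m+o≡n n<i
      nth≡ = trans (cong (nth (xs ++ ys)) (trans (sym i≡) (sym (+-suc (length xs) o)))) (nth-++ʳ xs ys (suc o) (s≤s z≤n))
  in subst (_≤ d) (sym nth≡) (nth-≤ ys≤d (suc o))

All-nth : (P : ℕ → Set) → ∀ xs → (∀ i → 1 ≤ i → i ≤ length xs → P (nth xs i)) → All P xs
All-nth P []       _ = []
All-nth P (x ∷ xs) p = p 1 ≤-refl (s≤s z≤n)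
                   ∷ All-nth P xs (λ i 1≤i i≤n → subst P (nth-∷ x xs i 1≤i) (p (suc i) (s≤s z≤n) (s≤s i≤n)))

module _ (P : ℕ → Bool) where

  maxSat-≤ : ∀ t → maxSat P t ≤ t
  maxSat-≤ zero    = z≤n
  maxSat-≤ (suc t) with P (suc t)
  ... | true  = ≤-refl
  ... | false = m≤n⇒m≤1+n (maxSat-≤ t)

  maxSat-holds : ∀ t → 1 ≤ maxSat P t → P (maxSat P t) ≡ true
  maxSat-holds (suc t) 1≤m with P (suc t) in eq
  ... | true  = eq
  ... | false = maxSat-holds t 1≤m

  maxSat-≥ : ∀ t j → P j ≡ true → 1 ≤ j → j ≤ t → j ≤ maxSat P t
  maxSat-≥ zero    (suc j) _  _   ()
  maxSat-≥ (suc t) j Pj 1≤j j≤t with P (suc t) in eq | m≤n⇒m<n∨m≡n j≤t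
  ... | true  | _              = j≤t
  ... | false | inj₁ (s≤s j≤t) = maxSat-≥ t j Pj 1≤j j≤t
  ... | false | inj₂ refl      = contradiction (trans (sym Pj) eq) λ ()

  maxSat-unique : ∀ t d → d ≤ t → (1 ≤ d → P d ≡ true) → (∀ e → d < e → e ≤ t → P e ≡ false) →
                  maxSat P t ≡ d
  maxSat-unique t d d≤t Pd above = ≤-antisym (≮⇒≥ not-above) (d≤m d Pd d≤t)
    where
    not-above : ¬ d < maxSat P t
    not-above d<m = contradiction (trans (sym (maxSat-holds t (≤-trans (s≤s z≤n) d<m))) (above _ d<m (maxSat-≤ t))) λ ()
    d≤m : ∀ d → (1 ≤ d → P d ≡ true) → d ≤ t → d ≤ maxSat P t
    d≤m zero    _  _   = z≤n
    d≤m (suc d) Pd d≤t = maxSat-≥ t (suc d) (Pd (s≤s z≤n)) (s≤s z≤n) d≤t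

-- Successive Durfee squares

sq-++ : ∀ xs ys → All (length xs ≤_) xs → All (_≤ length xs) ys → sq (xs ++ ys) ≡ length xs
sq-++ xs ys xs≥ ys≤ = maxSat-unique _ (length (xs ++ ys)) (length xs) (length-++-≤ˡ xs) (corner xs xs≥) beyond
  where
  corner : ∀ xs → All (length xs ≤_) xs → 1 ≤ length xs →
           ⌊ length xs ≤? nth (xs ++ ys) (length xs) ⌋ ≡ true
  corner xs@(_ ∷ xs′) xs≥ _ = ⌊⌋-true (length xs ≤? nth (xs ++ ys) (length xs))
    (subst (length xs ≤_) (sym (nth-++ˡ xs ys (length xs′) ≤-refl)) (nth-≥ xs≥ (length xs) (s≤s z≤n) ≤-refl))
  beyond : ∀ e → length xs < e → e ≤ length (xs ++ ys) → ⌊ e ≤? nth (xs ++ ys) e ⌋ ≡ false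
  beyond e n<e _ = ⌊⌋-false (e ≤? nth (xs ++ ys) e) (<⇒≱ (≤-<-trans (nth-beyond xs ys e ys≤ n<e) n<e))

residual-++ : ∀ j xs ys → All (length xs ≤_) xs → All (_≤ length xs) ys →
              residual (suc j) (xs ++ ys) ≡ residual j ys
residual-++ j xs ys xs≥ ys≤ rewrite sq-++ xs ys xs≥ ys≤ | drop-++-length xs ys = refl

sides-++ : ∀ j xs ys → All (length xs ≤_) xs → All (_≤ length xs) ys →
           sides (suc j) (xs ++ ys) ≡ length xs ∷ sides j ys
sides-++ j xs ys xs≥ ys≤ rewrite sq-++ xs ys xs≥ ys≤ | drop-++-length xs ys = refl

length-sides : ∀ k μ → length (sides k μ) ≡ k
length-sides zero    μ = refl
length-sides (suc k) μ = cong suc (length-sides k (drop (sq μ) μ))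

length-from-sides : ∀ {cs : List (List ℕ)} k μ → map length cs ≡ sides k μ → length cs ≡ k
length-from-sides {cs} k μ |cs|≡ = trans (sym (length-map length cs)) (trans (cong length |cs|≡) (length-sides k μ))

sq-positive : ∀ {x μ} → 1 ≤ x → 1 ≤ sq (x ∷ μ)
sq-positive {x} {μ} 1≤x = maxSat-≥ _ (length (x ∷ μ)) 1 (⌊⌋-true (1 ≤? x) 1≤x) ≤-refl (s≤s z≤n)

Sorted : List ℕ → Set
Sorted = AllPairs _≥_

Sorted-++ : ∀ {d xs ys} → Sorted xs → Sorted ys → All (d ≤_) xs → All (_≤ d) ys → Sorted (xs ++ ys)
Sorted-++ xs↓ ys↓ xs≥ ys≤ =
  AllPairsₚ.++⁺ xs↓ ys↓ (All.map (λ d≤x → All.map (λ y≤d → ≤-trans y≤d d≤x) ys≤) xs≥)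

Sorted-++⁻ : ∀ xs {ys} → Sorted (xs ++ ys) → Sorted xs × Sorted ys
Sorted-++⁻ []       ys↓              = [] , ys↓
Sorted-++⁻ (x ∷ xs) (x≥xs++ys ∷ xs++ys↓) =
  Allₚ.++⁻ˡ xs x≥xs++ys ∷ proj₁ (Sorted-++⁻ xs xs++ys↓) , proj₂ (Sorted-++⁻ xs xs++ys↓)

Sorted-head : ∀ {d x xs} → Sorted (x ∷ xs) → x ≤ d → All (_≤ d) (x ∷ xs)
Sorted-head (x≥xs ∷ _) x≤d = x≤d ∷ All.map (λ y≤x → ≤-trans y≤x x≤d) x≥xs

Sorted-last : ∀ xs → Sorted xs → All (nth xs (length xs) ≤_) xs
Sorted-last []           _                   = []
Sorted-last (x ∷ [])     _                   = ≤-refl ∷ []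
Sorted-last (x ∷ y ∷ ys) ((y≤x ∷ _) ∷ y∷ys↓) with Sorted-last (y ∷ ys) y∷ys↓
... | last≤y ∷ last≤ys = ≤-trans last≤y y≤x ∷ last≤y ∷ last≤ys

Sorted-map : ∀ {f : ℕ → ℕ} → (∀ {a b} → a ≤ b → f a ≤ f b) → ∀ {xs} → Sorted xs → Sorted (map f xs)
Sorted-map f-mono xs↓ = AllPairsₚ.map⁺ (AllPairs.map f-mono xs↓)

Sorted⇐Linked : ∀ {xs} → Linked _≥_ xs → Sorted xs
Sorted⇐Linked = Linked⇒AllPairs (λ x≥y y≥z → ≤-trans y≥z x≥y)

All-residual : {P : ℕ → Set} → ∀ k {μ} → All P μ → All P (residual k μ)
All-residual zero    Pμ = Pμ
All-residual (suc k) {μ} Pμ = All-residual k (Allₚ.drop⁺ (sq μ) Pμ)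

Sorted-residual : ∀ k {μ} → Sorted μ → Sorted (residual k μ)
Sorted-residual zero    μ↓ = μ↓
Sorted-residual (suc k) {μ} μ↓ = Sorted-residual k (AllPairsₚ.drop⁺ (sq μ) μ↓)

stack : List (List ℕ) → List ℕ → List ℕ
stack bs Y = foldr _++_ Y bs

-- B is the Durfee square of B ++ R
record IsSquare (B R : List ℕ) : Set where
  constructor isSquare
  field
    nonempty : 1 ≤ length B
    sorted   : Sorted B
    above    : All (length B ≤_) B
    below    : All (_≤ length B) R

sq-square : ∀ {B R} → IsSquare B R → sq (B ++ R) ≡ length B
sq-square {B} {R} (isSquare _ _ above below) = sq-++ B R above below

data Squares : List (List ℕ) → List ℕ → Set where
  []  : ∀ {Y} → Squares [] Y
  _∷_ : ∀ {B bs Y} → IsSquare B (stack bs Y) → Squares bs Y → Squares (B ∷ bs) Y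

Squares-head : ∀ {B bs Y} → Squares (B ∷ bs) Y → IsSquare B (stack bs Y)
Squares-head (sq-B ∷ _) = sq-B

Squares-tail : ∀ {B bs Y} → Squares (B ∷ bs) Y → Squares bs Y
Squares-tail (_ ∷ sq-bs) = sq-bs

stack-++ : ∀ xs ys Y → stack (xs ++ ys) Y ≡ stack xs (stack ys Y)
stack-++ xs ys Y = foldr-++ _++_ Y xs ys

length-stack : ∀ bs Y → length (stack bs Y) ≡ sum (map length bs) + length Y
length-stack []       Y = refl
length-stack (B ∷ bs) Y = trans (length-++ B) (trans (cong (length B +_) (length-stack bs Y)) (sym (+-assoc (length B) _ _)))

All-stack : {P : ℕ → Set} → ∀ bs {Y Y′} → (All P Y → All P Y′) → All P (stack bs Y) → All P (stack bs Y′)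
All-stack []       f pY      = f pY
All-stack (B ∷ bs) f pB++bsY = Allₚ.++⁺ (Allₚ.++⁻ˡ B pB++bsY) (All-stack bs f (Allₚ.++⁻ʳ B pB++bsY))

take-stack : ∀ bs Y → take (sum (map length bs)) (stack bs Y) ≡ stack bs []
take-stack []       Y = refl
take-stack (B ∷ bs) Y = trans (take-length-++ B (stack bs Y) _) (cong (B ++_) (take-stack bs Y))

drop-stack : ∀ bs Y → drop (sum (map length bs)) (stack bs Y) ≡ Y
drop-stack []       Y = refl
drop-stack (B ∷ bs) Y = trans (drop-length-++ B (stack bs Y) _) (drop-stack bs Y)

stack-[]-++ : ∀ bs Y → stack bs [] ++ Y ≡ stack bs Y
stack-[]-++ []       Y = refl
stack-[]-++ (B ∷ bs) Y = trans (++-assoc B (stack bs []) Y) (cong (B ++_) (stack-[]-++ bs Y))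

stack-nonempty : ∀ bs {Y : List ℕ} → ¬ Y ≡ [] → ¬ stack bs Y ≡ []
stack-nonempty []       Y≢[] = Y≢[]
stack-nonempty (B ∷ bs) Y≢[] = stack-nonempty bs Y≢[] ∘ ++-conicalʳ B _

Squares-++⁻ : ∀ xs {ys Y} → Squares (xs ++ ys) Y → Squares xs (stack ys Y) × Squares ys Y
Squares-++⁻ []       sq-ys                           = [] , sq-ys
Squares-++⁻ (B ∷ xs) {ys} {Y} (isSquare n s a below ∷ sq-xs++ys) =
  isSquare n s a (subst (All (_≤ length B)) (stack-++ xs ys Y) below) ∷ proj₁ (Squares-++⁻ xs sq-xs++ys) ,
  proj₂ (Squares-++⁻ xs sq-xs++ys)

Squares-mono-tail : ∀ {bs Y Y′} → (∀ d → All (_≤ d) Y → All (_≤ d) Y′) → Squares bs Y → Squares bs Y′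
Squares-mono-tail f []                                  = []
Squares-mono-tail f (_∷_ {B} {bs} (isSquare n s a below) sq-bs) =
  isSquare n s a (All-stack bs (f (length B)) below) ∷ Squares-mono-tail f sq-bs

residual-stack : ∀ {bs Y} j → Squares bs Y → residual (length bs + j) (stack bs Y) ≡ residual j Y
residual-stack j []                                           = refl
residual-stack {B ∷ bs} {Y} j (isSquare _ _ above below ∷ sq-bs) =
  trans (residual-++ (length bs + j) B (stack bs Y) above below) (residual-stack j sq-bs)

sides-stack : ∀ {bs Y} → Squares bs Y → sides (length bs) (stack bs Y) ≡ map length bs
sides-stack []                                           = refl
sides-stack {B ∷ bs} {Y} (isSquare _ _ above below ∷ sq-bs) =
  trans (sides-++ (length bs) B (stack bs Y) above below) (cong (length B ∷_) (sides-stack sq-bs))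

residual-stack-nonempty : ∀ {bs Y} j → Squares bs Y → length bs ≡ suc j → ¬ residual j (stack bs Y) ≡ []
residual-stack-nonempty {(_ ∷ _) ∷ bs} zero    (_ ∷ _) _ ()
residual-stack-nonempty {B ∷ bs} {Y} (suc j) (isSquare _ _ above below ∷ sq-bs) |bs|≡ =
  subst (λ ρ → ¬ ρ ≡ []) (sym (residual-++ j B (stack bs Y) above below))
        (residual-stack-nonempty j sq-bs (suc-injective |bs|≡))

Squares-nonempty : ∀ {bs Y} → Squares bs Y → All (1 ≤_) (map length bs)
Squares-nonempty []                          = []
Squares-nonempty (isSquare 1≤n _ _ _ ∷ sq-bs) = 1≤n ∷ Squares-nonempty sq-bs

Sorted-stack : ∀ {bs Y} → Squares bs Y → Sorted Y → Sorted (stack bs Y)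
Sorted-stack []                                  Y↓ = Y↓
Sorted-stack (isSquare _ B↓ above below ∷ sq-bs) Y↓ = Sorted-++ B↓ (Sorted-stack sq-bs Y↓) above below

Positive-stack : ∀ {bs Y} → Squares bs Y → All (0 <_) Y → All (0 <_) (stack bs Y)
Positive-stack []                                  Y>0 = Y>0
Positive-stack (isSquare 1≤n _ above _ ∷ sq-bs) Y>0 =
  Allₚ.++⁺ (All.map (≤-trans 1≤n) above) (Positive-stack sq-bs Y>0)

-- o counts rows already placed above μ; this generalisation lets the recursion go through.
durfee-split-from : ∀ o μ → Sorted μ →
  ∃₂ λ xs ys → xs ++ ys ≡ μ × All (o + length xs ≤_) xs × All (_≤ o + length xs) ys
durfee-split-from o []       _            = [] , [] , refl , [] , []
durfee-split-from o (x ∷ μ) x∷μ↓@(x≥μ ∷ μ↓) with suc o ≤? x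
... | no o≮x = [] , x ∷ μ , refl , [] , Sorted-head x∷μ↓ (subst (x ≤_) (sym (+-identityʳ o)) (≤-pred (≰⇒> o≮x)))
... | yes o<x with durfee-split-from (suc o) μ μ↓
...   | xs , ys , refl , xs≥ , ys≤ =
  x ∷ xs , ys , refl ,
  corner xs xs≥ x≥μ ∷ All.map (λ {w} → subst (_≤ w) o+|xs|) xs≥ , All.map (λ {w} → subst (w ≤_) o+|xs|) ys≤
  where
  o+|xs| : suc o + length xs ≡ o + suc (length xs)
  o+|xs| = sym (+-suc o (length xs))
  corner : ∀ xs → All (suc o + length xs ≤_) xs → All (_≤ x) (xs ++ ys) → o + suc (length xs) ≤ x
  corner []       _            _          = subst (_≤ x) (sym (+-comm o 1)) o<x
  corner (y ∷ xs) (y≥ ∷ _) (y≤x ∷ _) = subst (_≤ x) (sym (+-suc o (length (y ∷ xs)))) (≤-trans y≥ y≤x)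

durfee-split : ∀ μ → Sorted μ → ∃₂ λ xs ys → xs ++ ys ≡ μ × All (length xs ≤_) xs × All (_≤ length xs) ys
durfee-split = durfee-split-from 0

squares-of : ∀ k μ → Sorted μ → All (1 ≤_) (sides k μ) →
  ∃ λ cs → Squares cs (residual k μ) × stack cs (residual k μ) ≡ μ × map length cs ≡ sides k μ
squares-of zero    μ _  _ = [] , [] , refl , refl
squares-of (suc k) μ μ↓ sides>0 with durfee-split μ μ↓
... | xs , ys , refl , xs≥ , ys≤
  rewrite residual-++ k xs ys xs≥ ys≤ | sides-++ k xs ys xs≥ ys≤
  with sides>0
... | 1≤|xs| ∷ sides-ys>0 with squares-of k ys (proj₂ (Sorted-++⁻ xs μ↓)) sides-ys>0
... | cs , sq-cs , cs≡ys , |cs|≡ =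
  xs ∷ cs , isSquare 1≤|xs| (proj₁ (Sorted-++⁻ xs μ↓)) xs≥ (subst (All (_≤ length xs)) (sym cs≡ys) ys≤) ∷ sq-cs ,
  cong (xs ++_) cs≡ys , cong (length xs ∷_) |cs|≡

sides-positive : ∀ k μ → All (0 <_) μ → ¬ residual k μ ≡ [] → All (1 ≤_) (sides k μ)
sides-positive zero    μ       _         _  = []
sides-positive (suc k) []      _         ρ≢[] = contradiction (residual-[] k) ρ≢[]
  where
  residual-[] : ∀ k → residual k [] ≡ []
  residual-[] zero    = refl
  residual-[] (suc k) = residual-[] k
sides-positive (suc k) (x ∷ μ) x∷μ>0@(x>0 ∷ _) ρ≢[] =
  sq-positive {μ = μ} x>0 ∷ sides-positive k (drop (sq (x ∷ μ)) (x ∷ μ)) (Allₚ.drop⁺ (sq (x ∷ μ)) x∷μ>0) ρ≢[]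

-- Raised and tight blocks

-- Block j of λ is raised iff j ∈ A_λ.
Raised : List ℕ → Set
Raised B = length B < nth B (length B)

Raised? : ∀ B → Dec (Raised B)
Raised? B = length B <? nth B (length B)

Tight : List ℕ → Set
Tight B = nth B (length B) ≡ length B

Raised⇒above : ∀ {B R} → IsSquare B R → Raised B → All (length B <_) B
Raised⇒above {B} (isSquare _ B↓ _ _) raised = All.map (<-≤-trans raised) (Sorted-last B B↓)

¬Raised⇒Tight : ∀ {B R} → IsSquare B R → ¬ Raised B → Tight B
¬Raised⇒Tight {B} (isSquare 1≤n _ above _) ¬raised = ≤-antisym (≮⇒≥ ¬raised) (nth-≥ above (length B) 1≤n ≤-refl)

Tight⇒∷ʳ : ∀ C → 1 ≤ length C → Tight C → ∃ λ C′ → C ≡ C′ ∷ʳ suc (length C′)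
Tight⇒∷ʳ C 1≤n tight with initLast C
... | C′ ∷ʳ′ c = C′ , cong (C′ ∷ʳ_) c≡
  where
  |C| : length (C′ ∷ʳ c) ≡ suc (length C′)
  |C| = length-∷ʳ C′ c
  c≡ : c ≡ suc (length C′)
  c≡ = begin
    c                                   ≡⟨ nth-last C′ c ⟨
    nth (C′ ∷ʳ c) (suc (length C′))     ≡⟨ cong (nth (C′ ∷ʳ c)) |C| ⟨
    nth (C′ ∷ʳ c) (length (C′ ∷ʳ c))    ≡⟨ tight ⟩
    length (C′ ∷ʳ c)                    ≡⟨ |C| ⟩
    suc (length C′)                     ∎
    where open ≡-Reasoning

∷ʳ-Tight : ∀ C′ → Tight (C′ ∷ʳ suc (length C′))
∷ʳ-Tight C′ = trans (cong (nth (C′ ∷ʳ _)) (length-∷ʳ C′ _)) (trans (nth-last C′ _) (sym (length-∷ʳ C′ _)))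

with-below : ∀ {C R R′} → IsSquare C R → All (_≤ length C) R′ → IsSquare C R′
with-below (isSquare 1≤|C| C↓ C≥ _) R′≤ = isSquare 1≤|C| C↓ C≥ R′≤

shift-tight : ∀ {d C R} → IsSquare C R → Tight C → All (_≤ d) C →
  ∃ λ C′ → C ≡ C′ ∷ʳ suc (length C′) × IsSquare (d ∷ C′) (suc (length C′) ∷ R)
shift-tight {d} {C} {R} (isSquare 1≤|C| C↓ C≥ R≤) tight C≤d with Tight⇒∷ʳ C 1≤|C| tight
... | C′ , refl =
  C′ , refl , isSquare (s≤s z≤n) (C′≤d ∷ proj₁ (Sorted-++⁻ C′ C↓)) (c≤d ∷ C′≥c) (≤-refl ∷ R≤c)
  where
  c = suc (length C′)
  |C| : length (C′ ∷ʳ c) ≡ c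
  |C| = length-∷ʳ C′ c
  C′≤d : All (_≤ d) C′
  C′≤d = Allₚ.++⁻ˡ C′ C≤d
  c≤d : c ≤ d
  c≤d = proj₂ (Allₚ.∷ʳ⁻ C≤d)
  C′≥c : All (c ≤_) C′
  C′≥c = Allₚ.++⁻ˡ C′ (subst (λ n → All (n ≤_) (C′ ∷ʳ c)) |C| C≥)
  R≤c : All (_≤ c) R
  R≤c = subst (λ n → All (_≤ n) R) |C| R≤

unshift-square : ∀ {d C′ R} → IsSquare (d ∷ C′) (suc (length C′) ∷ R) → IsSquare (C′ ∷ʳ suc (length C′)) R
unshift-square {d} {C′} {R} (isSquare _ (_ ∷ C′↓) (_ ∷ C′≥) (_ ∷ R≤)) =
  isSquare (subst (1 ≤_) (sym |C|) (s≤s z≤n)) (Sorted-++ C′↓ ([] ∷ []) C′≥ (≤-refl ∷ []))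
           (subst (λ n → All (n ≤_) (C′ ∷ʳ c)) (sym |C|) (Allₚ.∷ʳ⁺ C′≥ ≤-refl))
           (subst (λ n → All (_≤ n) R) (sym |C|) R≤)
  where
  c = suc (length C′)
  |C| : length (C′ ∷ʳ c) ≡ c
  |C| = length-∷ʳ C′ c

pred-above : ∀ {d} B → All (d <_) B → All (d ≤_) (map pred B)
pred-above B d<B = Allₚ.map⁺ (All.map (λ { {suc _} (s≤s d≤b) → d≤b }) d<B)

lower-square : ∀ {B R} → IsSquare B R → All (length B <_) B → IsSquare (map pred B) (length B ∷ R)
lower-square {B} {R} (isSquare 1≤|B| B↓ _ R≤) B> =
  isSquare (subst (1 ≤_) |B|≡ 1≤|B|) (Sorted-map pred-mono-≤ B↓)
           (subst (λ n → All (n ≤_) (map pred B)) |B|≡ (pred-above B B>))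
           (subst (λ n → All (_≤ n) (length B ∷ R)) |B|≡ (≤-refl ∷ R≤))
  where
  |B|≡ : length B ≡ length (map pred B)
  |B|≡ = sym (length-map pred B)

raise-square : ∀ {C R} → IsSquare C R → IsSquare (map suc C) R
raise-square {C} {R} (isSquare 1≤|C| C↓ C≥ R≤) =
  isSquare (subst (1 ≤_) |C|≡ 1≤|C|) (Sorted-map s≤s C↓)
           (subst (λ n → All (n ≤_) (map suc C)) |C|≡ (Allₚ.map⁺ (All.map m≤n⇒m≤1+n C≥)))
           (subst (λ n → All (_≤ n) R) |C|≡ R≤)
  where
  |C|≡ : length C ≡ length (map suc C)
  |C|≡ = sym (length-map suc C)

raise-raised : ∀ {C R} → IsSquare C R → Raised (map suc C)
raise-raised {C} (isSquare 1≤|C| _ C≥ _) = subst (λ n → n < nth (map suc C) n) (sym (length-map suc C))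
  (subst (length C <_) (sym (nth-map-suc C (length C) 1≤|C| ≤-refl)) (s≤s (nth-≥ C≥ (length C) 1≤|C| ≤-refl)))
  where
  nth-map-suc : ∀ X i → 1 ≤ i → i ≤ length X → nth (map suc X) i ≡ suc (nth X i)
  nth-map-suc (x ∷ X) (suc zero)    _ _         = refl
  nth-map-suc (x ∷ X) (suc (suc i)) _ (s≤s i≤n) = nth-map-suc X (suc i) (s≤s z≤n) i≤n

side-at : ∀ (pre : List (List ℕ)) C post → nth (map length (pre ++ C ∷ post)) (suc (length pre)) ≡ length C
side-at pre C post = begin
  nth (map length (pre ++ C ∷ post)) (suc (length pre))
    ≡⟨ cong (λ s → nth s (suc (length pre))) (map-++ length pre (C ∷ post)) ⟩
  nth (map length pre ++ length C ∷ map length post) (suc (length pre))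
    ≡⟨ cong (λ i → nth (map length pre ++ length C ∷ map length post) (suc i)) (length-map length pre) ⟨
  nth (map length pre ++ length C ∷ map length post) (suc (length (map length pre)))
    ≡⟨ nth-middle (map length pre) (length C) (map length post) ⟩
  length C ∎
  where open ≡-Reasoning

prefix-sum-positive : ∀ pre C post {Y} → Squares (pre ++ C ∷ post) Y →
  1 ≤ sum (take (suc (length pre)) (map length (pre ++ C ∷ post)))
prefix-sum-positive []      C post (isSquare 1≤n _ _ _ ∷ _) = ≤-trans 1≤n (m≤m+n _ _)
prefix-sum-positive (_ ∷ _) C post (isSquare 1≤n _ _ _ ∷ _) = ≤-trans 1≤n (m≤m+n _ _)

corner-at : ∀ pre C post {Y} → Squares (pre ++ C ∷ post) Y →
  nth (stack (pre ++ C ∷ post) Y) (sum (take (suc (length pre)) (map length (pre ++ C ∷ post)))) ≡ nth C (length C)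
corner-at [] [] post (isSquare () _ _ _ ∷ _)
corner-at [] C@(_ ∷ C′) post {Y} _ =
  trans (cong (nth (C ++ stack post Y)) (+-identityʳ (length C))) (nth-++ˡ C (stack post Y) (length C′) ≤-refl)
corner-at (D ∷ pre) C post {Y} (_ ∷ sq) =
  trans (nth-++ʳ D (stack (pre ++ C ∷ post) Y) _ (prefix-sum-positive pre C post sq)) (corner-at pre C post sq)

-- The marked block

-- λ = source pre B post, cut into its successive Durfee squares, with B the block at position M_λ.
record Marked (pre : List (List ℕ)) (B : List ℕ) (post : List (List ℕ)) : Set where
  constructor marked
  field
    squares : Squares (pre ++ B ∷ post) []
    raised  : Raised B
    tight   : All Tight post

source : List (List ℕ) → List ℕ → List (List ℕ) → List ℕ
source pre B post = stack (pre ++ B ∷ post) []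

lowered : List (List ℕ) → List ℕ → List (List ℕ) → List ℕ
lowered pre B post = stack pre (map pred B ++ length B ∷ stack post [])

Marked-tail : ∀ {D pre B post} → Marked (D ∷ pre) B post → Marked pre B post
Marked-tail (marked (_ ∷ sq-bs) raised tight) = marked sq-bs raised tight

Sorted-source : ∀ {pre B post} → Marked pre B post → Sorted (source pre B post)
Sorted-source m = Sorted-stack (Marked.squares m) []

Squares⇒Tight : ∀ {bs Y} → Squares bs Y → All (¬_ ∘ Raised) bs → All Tight bs
Squares⇒Tight []                     []                    = []
Squares⇒Tight (sq-B ∷ sq-bs) (¬raised ∷ ¬raised-bs) = ¬Raised⇒Tight sq-B ¬raised ∷ Squares⇒Tight sq-bs ¬raised-bs

mark-last-raised : ∀ {bs} → Squares bs [] → Any Raised bs →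
  ∃ λ pre → ∃ λ B → ∃ λ post → Marked pre B post × bs ≡ pre ++ B ∷ post
mark-last-raised sq-bs any-raised with split-last Raised? any-raised
... | pre , B , post , refl , raised , ¬raised-post with Squares-++⁻ pre sq-bs
...   | _ , _ ∷ sq-post = pre , B , post , marked sq-bs raised (Squares⇒Tight sq-post ¬raised-post) , refl

-- T' r p is lowerAt (psum r p (M ∸ 1)) (side r p M) p with M = Mλ r p.
lowerAt : ℕ → ℕ → List ℕ → List ℕ
lowerAt N m p = take N p ++ map pred (take m (drop N p)) ++ m ∷ drop (N + m) p

lowerAt-stack : ∀ pre B R →
  lowerAt (sum (map length pre)) (length B) (stack pre (B ++ R)) ≡ stack pre (map pred B ++ length B ∷ R)
lowerAt-stack pre B R
  rewrite take-stack pre (B ++ R) | sym (drop-drop (sum (map length pre)) (length B) (stack pre (B ++ R)))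
        | drop-stack pre (B ++ R) | take-++-length B R | drop-++-length B R = stack-[]-++ pre _

module _ (k : ℕ) where

  private
    r : ℕ
    r = suc (suc k)

  length-blocks : ∀ (pre : List (List ℕ)) B post → length pre + length post ≡ k → length (pre ++ B ∷ post) ≡ suc k
  length-blocks pre B post len = trans (length-++-∷ pre B post) (cong suc len)

  raisedAt : List ℕ → ℕ → Bool
  raisedAt p j = ⌊ side r p j <? nth p (psum r p j) ⌋

  sides-stack-at : ∀ {bs Y} → Squares bs Y → length bs ≡ suc k → sides (suc k) (stack bs Y) ≡ map length bs
  sides-stack-at {bs} {Y} sq-bs |bs| = subst (λ m → sides m (stack bs Y) ≡ map length bs) |bs| (sides-stack sq-bs)

  raisedAt-block : ∀ {bs} pre C post → bs ≡ pre ++ C ∷ post → Squares bs [] → length bs ≡ suc k →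
                   raisedAt (stack bs []) (suc (length pre)) ≡ ⌊ Raised? C ⌋
  raisedAt-block {bs} pre C post refl sq-bs |bs| = cong₂ (λ a b → ⌊ a <? b ⌋) side≡ corner≡
    where
    sides≡ : sides (suc k) (stack bs []) ≡ map length bs
    sides≡ = sides-stack-at sq-bs |bs|
    side≡ : side r (stack bs []) (suc (length pre)) ≡ length C
    side≡ = trans (cong (λ s → nth s (suc (length pre))) sides≡) (side-at pre C post)
    corner≡ : nth (stack bs []) (psum r (stack bs []) (suc (length pre))) ≡ nth C (length C)
    corner≡ = trans (cong (λ s → nth (stack bs []) (sum (take (suc (length pre)) s))) sides≡) (corner-at pre C post sq-bs)

  Mλ-source : ∀ {pre B post} → Marked pre B post → length pre + length post ≡ k →
              Mλ r (source pre B post) ≡ suc (length pre)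
  Mλ-source {pre} {B} {post} (marked sq-bs raised tight) len =
    maxSat-unique (raisedAt p) (suc k) (suc (length pre)) (s≤s (≤-trans (m≤m+n _ _) (≤-reflexive len)))
      (λ _ → trans (raisedAt-block pre B post refl sq-bs |bs|) (⌊⌋-true (Raised? B) raised))
      above
    where
    p = source pre B post
    |bs| : length (pre ++ B ∷ post) ≡ suc k
    |bs| = length-blocks pre B post len
    above : ∀ e → suc (length pre) < e → e ≤ suc k → raisedAt p e ≡ false
    above e pre<e e≤k =
      let i , e≡ = m≤n⇒∃[o]m+o≡n pre<e
          i<|post| = +-cancelˡ-≤ (length pre) _ _
                       (≤-trans (≤-reflexive (+-suc (length pre) i))
                                (≤-trans (s≤s⁻¹ (subst (_≤ suc k) (sym e≡) e≤k)) (≤-reflexive (sym len))))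
          post₁ , C , post₂ , post≡ , |post₁|≡i = split-at post i i<|post|
          bs≡ = trans (cong (λ ps → pre ++ B ∷ ps) post≡) (sym (++-assoc pre (B ∷ post₁) (C ∷ post₂)))
          tight-C = All.head (Allₚ.++⁻ʳ post₁ (subst (All Tight) post≡ tight))
      in begin
        raisedAt p e
          ≡⟨ cong (raisedAt p) (trans (sym e≡) (cong (λ j → suc (suc (length pre + j))) (sym |post₁|≡i))) ⟩
        raisedAt p (suc (suc (length pre + length post₁)))
          ≡⟨ cong (λ j → raisedAt p (suc j)) (length-++-∷ pre B post₁) ⟨
        raisedAt p (suc (length (pre ++ B ∷ post₁)))
          ≡⟨ raisedAt-block (pre ++ B ∷ post₁) C post₂ bs≡ sq-bs |bs| ⟩
        ⌊ Raised? C ⌋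
          ≡⟨ ⌊⌋-false (Raised? C) (<-irrefl (sym tight-C)) ⟩
        false ∎
      where open ≡-Reasoning

  T-source : ∀ {pre B post} → Marked pre B post → length pre + length post ≡ k →
             T r (source pre B post) ≡ lowered pre B post
  T-source {pre} {B} {post} m@(marked sq-bs _ _) len = begin
    T r p
      ≡⟨ cong (if_then p else T' r p) (isEmpty-nonempty (residual-stack-nonempty k sq-bs |bs|)) ⟩
    lowerAt (psum r p (Mλ r p ∸ 1)) (side r p (Mλ r p)) p
      ≡⟨ cong₂ (λ N m → lowerAt N m p) N≡ m≡ ⟩
    lowerAt (sum (map length pre)) (length B) p
      ≡⟨ cong (lowerAt (sum (map length pre)) (length B)) (stack-++ pre (B ∷ post) []) ⟩
    lowerAt (sum (map length pre)) (length B) (stack pre (B ++ stack post []))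
      ≡⟨ lowerAt-stack pre B (stack post []) ⟩
    lowered pre B post ∎
    where
    open ≡-Reasoning
    p = source pre B post
    |bs| : length (pre ++ B ∷ post) ≡ suc k
    |bs| = length-blocks pre B post len
    sides≡ : sides (suc k) p ≡ map length (pre ++ B ∷ post)
    sides≡ = sides-stack-at sq-bs |bs|
    isEmpty-nonempty : ∀ {xs} → ¬ xs ≡ [] → isEmpty xs ≡ false
    isEmpty-nonempty {[]}    xs≢[] = contradiction refl xs≢[]
    isEmpty-nonempty {_ ∷ _} _     = refl
    N≡ : psum r p (Mλ r p ∸ 1) ≡ sum (map length pre)
    N≡ = begin
      sum (take (Mλ r p ∸ 1) (sides (suc k) p))
        ≡⟨ cong₂ (λ M S → sum (take (M ∸ 1) S)) (Mλ-source m len) sides≡ ⟩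
      sum (take (length pre) (map length (pre ++ B ∷ post)))
        ≡⟨ cong (λ S → sum (take (length pre) S)) (map-++ length pre (B ∷ post)) ⟩
      sum (take (length pre) (map length pre ++ map length (B ∷ post)))
        ≡⟨ cong (λ n → sum (take n (map length pre ++ map length (B ∷ post)))) (length-map length pre) ⟨
      sum (take (length (map length pre)) (map length pre ++ map length (B ∷ post)))
        ≡⟨ cong sum (take-++-length (map length pre) _) ⟩
      sum (map length pre) ∎
    m≡ : side r p (Mλ r p) ≡ length B
    m≡ = trans (cong₂ nth sides≡ (Mλ-source m len)) (side-at pre B post)

  squares-of-A' : ∀ {n p} → A' r n p → ∃ λ cs → Squares cs [] × stack cs [] ≡ p × length cs ≡ suc k
  squares-of-A' {n} {p} (((p↓ , _) , _) , sides>0 , psum≡ , _)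
    with squares-of (suc k) p (Sorted⇐Linked p↓) (All-nth (1 ≤_) (sides (suc k) p) sides>0′)
    where
    sides>0′ : ∀ i → 1 ≤ i → i ≤ length (sides (suc k) p) → 1 ≤ nth (sides (suc k) p) i
    sides>0′ i 1≤i i≤ = sides>0 i 1≤i (subst (i ≤_) (length-sides (suc k) p) i≤)
  ... | cs , sq-cs , cs≡p , |cs|≡ =
    cs , subst (Squares cs) ρ≡[] sq-cs , trans (cong (stack cs) (sym ρ≡[])) cs≡p , length-from-sides (suc k) p |cs|≡
    where
    open ≡-Reasoning
    ρ = residual (suc k) p
    length≡0 : ∀ {xs : List ℕ} → length xs ≡ 0 → xs ≡ []
    length≡0 {[]} _ = refl
    ρ≡[] : ρ ≡ []
    ρ≡[] = length≡0 (+-cancelˡ-≡ (sum (map length cs)) _ 0 (begin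
      sum (map length cs) + length ρ         ≡⟨ length-stack cs ρ ⟨
      length (stack cs ρ)                    ≡⟨ cong length cs≡p ⟩
      length p                               ≡⟨ psum≡ ⟨
      sum (take (suc k) (sides (suc k) p))   ≡⟨ cong sum (take-all (suc k) _ (≤-reflexive (length-sides (suc k) p))) ⟩
      sum (sides (suc k) p)                  ≡⟨ cong sum |cs|≡ ⟨
      sum (map length cs)                    ≡⟨ +-identityʳ _ ⟨
      sum (map length cs) + 0                ∎))

  marked-of-A' : ∀ {n p} → A' r n p →
    ∃ λ pre → ∃ λ B → ∃ λ post → Marked pre B post × source pre B post ≡ p × length pre + length post ≡ k
  marked-of-A' (_ , _ , _ , zero , () , _)
  marked-of-A' {p = p} a'@(_ , _ , _ , suc i , _ , j≤ , raised-j) =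
    let cs , sq-cs , cs≡p , |cs| = squares-of-A' a'
        ys , C , zs , cs≡ , |ys|≡i = split-at cs i (subst (suc i ≤_) (sym |cs|) j≤)
        raised-C = ⌊⌋-true⁻¹ (Raised? C) (begin
          ⌊ Raised? C ⌋                         ≡⟨ raisedAt-block ys C zs cs≡ sq-cs |cs| ⟨
          raisedAt (stack cs []) (suc (length ys)) ≡⟨ cong₂ raisedAt cs≡p (cong suc |ys|≡i) ⟩
          raisedAt p (suc i)                    ≡⟨ ⌊⌋-true (_ <? _) raised-j ⟩
          true                                  ∎)
        pre , B , post , m , cs≡′ = mark-last-raised sq-cs (subst (Any Raised) (sym cs≡) (Anyₚ.++⁺ʳ ys (here raised-C)))
    in pre , B , post , m , trans (cong (λ bs → stack bs []) (sym cs≡′)) cs≡p ,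
       suc-injective (trans (sym (length-++-∷ pre B post)) (trans (cong length (sym cs≡′)) |cs|))
    where open ≡-Reasoning

  A'-source : ∀ {n pre B post} → Marked pre B post → length pre + length post ≡ k →
              sum (source pre B post) ≡ n → A' r n (source pre B post)
  A'-source {n} {pre} {B} {post} (marked sq-bs raised _) len sum≡n =
    ((AllPairs⇒Linked (Sorted-stack sq-bs []) , Positive-stack sq-bs []) , sum≡n) ,
    sides>0 , psum≡ , suc (length pre) , s≤s z≤n , s≤s (≤-trans (m≤m+n _ _) (≤-reflexive len)) , raised-M
    where
    open ≡-Reasoning
    bs = pre ++ B ∷ post
    p = source pre B post
    |bs| : length bs ≡ suc k
    |bs| = length-blocks pre B post len
    sides≡ : sides (suc k) p ≡ map length bs
    sides≡ = sides-stack-at sq-bs |bs|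
    sides>0 : ∀ j → 1 ≤ j → j ≤ suc k → 1 ≤ side r p j
    sides>0 j 1≤j j≤ = subst (λ S → 1 ≤ nth S j) (sym sides≡)
      (nth-≥ (Squares-nonempty sq-bs) j 1≤j (subst (j ≤_) (sym (trans (length-map length bs) |bs|)) j≤))
    psum≡ : psum r p (suc k) ≡ length p
    psum≡ = begin
      sum (take (suc k) (sides (suc k) p))  ≡⟨ cong (λ S → sum (take (suc k) S)) sides≡ ⟩
      sum (take (suc k) (map length bs))
        ≡⟨ cong sum (take-all (suc k) (map length bs) (≤-reflexive (trans (length-map length bs) |bs|))) ⟩
      sum (map length bs)                   ≡⟨ +-identityʳ _ ⟨
      sum (map length bs) + 0               ≡⟨ length-stack bs [] ⟨
      length p                              ∎
    raised-M : side r p (suc (length pre)) < nth p (psum r p (suc (length pre)))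
    raised-M = ⌊⌋-true⁻¹ (_ <? _) (trans (raisedAt-block pre B post refl sq-bs |bs|) (⌊⌋-true (Raised? B) raised))

-- Lowering the marked block

lower-bound : ∀ {d} B R → 1 ≤ length B → All (length B ≤_) B → All (_≤ d) (B ++ R) →
              All (_≤ d) (map pred B ++ length B ∷ R)
lower-bound (b ∷ B) R _ (|B|≤b ∷ _) B++R≤d@(b≤d ∷ _) =
  Allₚ.++⁺ (Allₚ.map⁺ (All.map (≤-trans pred[n]≤n) (Allₚ.++⁻ˡ (b ∷ B) B++R≤d)))
           (≤-trans |B|≤b b≤d ∷ Allₚ.++⁻ʳ (b ∷ B) B++R≤d)

sum-pred : ∀ B → All (0 <_) B → sum (map pred B) + length B ≡ sum B
sum-pred []          []      = refl
sum-pred (suc b ∷ B) (_ ∷ B>0) = begin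
  b + sum (map pred B) + suc (length B)    ≡⟨ +-suc _ (length B) ⟩
  suc (b + sum (map pred B) + length B)    ≡⟨ cong suc (+-assoc b _ _) ⟩
  suc (b + (sum (map pred B) + length B))  ≡⟨ cong (λ s → suc (b + s)) (sum-pred B B>0) ⟩
  suc (b + sum B)                          ∎
  where open ≡-Reasoning

sum-stack-cong : ∀ bs {Y Y′} → sum Y ≡ sum Y′ → sum (stack bs Y) ≡ sum (stack bs Y′)
sum-stack-cong []       Y≡Y′ = Y≡Y′
sum-stack-cong (B ∷ bs) Y≡Y′ = trans (sum-++ B _) (trans (cong (sum B +_) (sum-stack-cong bs Y≡Y′)) (sym (sum-++ B _)))

-- Each tight block moves up one row: the side of the previous square becomes its first part, and its last part drops out.
residual-tight : ∀ X₀ post → IsSquare X₀ (length X₀ ∷ stack post []) → Squares post [] → All Tight post →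
  ∃ λ X → residual (length post) (X₀ ++ length X₀ ∷ stack post []) ≡ X ∷ʳ length X
residual-tight X₀ []         _                   _                    _                = X₀ , refl
residual-tight X₀ (C ∷ post) sq-X₀@(isSquare _ _ X₀≥ (_ ∷ C++post≤)) (sq-C ∷ sq-post) (tight ∷ tights)
  with shift-tight sq-C tight (Allₚ.++⁻ˡ C C++post≤)
... | C′ , refl , sq-X₁ with residual-tight (length X₀ ∷ C′) post sq-X₁ sq-post tights
... | X , residual≡ = X , (begin
  residual (suc (length post)) (X₀ ++ length X₀ ∷ (C′ ∷ʳ c) ++ stack post [])
    ≡⟨ residual-++ (length post) X₀ _ X₀≥ (IsSquare.below sq-X₀) ⟩
  residual (length post) (length X₀ ∷ (C′ ∷ʳ c) ++ stack post [])
    ≡⟨ cong (λ ys → residual (length post) (length X₀ ∷ ys)) (∷ʳ-++ C′ c (stack post [])) ⟩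
  residual (length post) ((length X₀ ∷ C′) ++ c ∷ stack post [])
    ≡⟨ residual≡ ⟩
  X ∷ʳ length X ∎)
  where
  open ≡-Reasoning
  c = suc (length C′)

module Lowering {pre B post} (m : Marked pre B post) where
  open Marked m

  lowered-tail : List ℕ
  lowered-tail = map pred B ++ length B ∷ stack post []

  source≡ : source pre B post ≡ stack pre (B ++ stack post [])
  source≡ = stack-++ pre (B ∷ post) []

  pre-squares : Squares pre (B ++ stack post [])
  pre-squares = proj₁ (Squares-++⁻ pre squares)

  B-square : IsSquare B (stack post [])
  B-square = Squares-head (proj₂ (Squares-++⁻ pre squares))

  post-squares : Squares post []
  post-squares = Squares-tail (proj₂ (Squares-++⁻ pre squares))

  open IsSquare B-square

  B-above : All (length B <_) B
  B-above = Raised⇒above B-square raised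

  lowered-square : IsSquare (map pred B) (length B ∷ stack post [])
  lowered-square = lower-square B-square B-above

  lowered-squares : Squares pre lowered-tail
  lowered-squares = Squares-mono-tail (λ d → lower-bound B (stack post []) nonempty above) pre-squares

  Sorted-lowered : Sorted (lowered pre B post)
  Sorted-lowered = Sorted-stack lowered-squares
    (Sorted-++ (Sorted-map pred-mono-≤ sorted) (below ∷ Sorted-stack post-squares []) (pred-above B B-above) (≤-refl ∷ below))

  Positive-lowered : All (0 <_) (lowered pre B post)
  Positive-lowered = Positive-stack lowered-squares
    (Allₚ.++⁺ (All.map (≤-trans nonempty) (pred-above B B-above)) (nonempty ∷ Positive-stack post-squares []))

  sum-lowered : sum (lowered pre B post) ≡ sum (source pre B post)
  sum-lowered = trans (sum-stack-cong pre tail≡) (cong sum (sym source≡))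
    where
    open ≡-Reasoning
    tail≡ : sum lowered-tail ≡ sum (B ++ stack post [])
    tail≡ = begin
      sum (map pred B ++ length B ∷ stack post [])              ≡⟨ sum-++ (map pred B) _ ⟩
      sum (map pred B) + (length B + sum (stack post []))       ≡⟨ +-assoc (sum (map pred B)) _ _ ⟨
      sum (map pred B) + length B + sum (stack post [])
        ≡⟨ cong (_+ sum (stack post [])) (sum-pred B (All.map (≤-trans nonempty) above)) ⟩
      sum B + sum (stack post [])                               ≡⟨ sum-++ B _ ⟨
      sum (B ++ stack post [])                                  ∎

  residual-lowered : ∃ λ X → residual (length pre + length post) (lowered pre B post) ≡ X ∷ʳ length X
  residual-lowered with residual-tight (map pred B) post
                         (subst (λ n → IsSquare (map pred B) (n ∷ stack post [])) (sym (length-map pred B)) lowered-square)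
                         post-squares tight
  ... | X , residual≡ =
    X , trans (residual-stack (length post) lowered-squares)
              (trans (cong (λ n → residual (length post) (map pred B ++ n ∷ stack post [])) (sym (length-map pred B)))
                     residual≡)

vrect-∷ʳ : ∀ X → vrect (X ∷ʳ length X) ≡ suc (length X)
vrect-∷ʳ X rewrite length-∷ʳ X (length X) | nth-last X (length X) | ⌊⌋-true (length X ≤? length X) ≤-refl = refl

∷ʳ⇒vrect-shape : ∀ X → drop (vrect (X ∷ʳ length X)) (X ∷ʳ length X) ≡ [] ×
                        nth (X ∷ʳ length X) (vrect (X ∷ʳ length X)) ≡ vrect (X ∷ʳ length X) ∸ 1
∷ʳ⇒vrect-shape X rewrite vrect-∷ʳ X =
  drop-all (suc (length X)) (X ∷ʳ length X) (≤-reflexive (length-∷ʳ X (length X))) , nth-last X (length X)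

vrect-shape⇒∷ʳ : ∀ ρ → drop (vrect ρ) ρ ≡ [] → nth ρ (vrect ρ) ≡ vrect ρ ∸ 1 → ¬ ρ ≡ [] →
                 ∃ λ X → ρ ≡ X ∷ʳ length X
vrect-shape⇒∷ʳ ρ dropped corner ρ≢[] with initLast ρ
... | []      = contradiction refl ρ≢[]
... | X ∷ʳ′ x = X , cong (X ∷ʳ_) x≡
  where
  open ≡-Reasoning
  |ρ| : length (X ∷ʳ x) ≡ suc (length X)
  |ρ| = length-∷ʳ X x
  vrect≡ : vrect (X ∷ʳ x) ≡ suc (length X)
  vrect≡ = trans (≤-antisym (maxSat-≤ _ (length (X ∷ʳ x)))
                            (m∸n≡0⇒m≤n (trans (sym (length-drop (vrect (X ∷ʳ x)) (X ∷ʳ x))) (cong length dropped))))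
                 |ρ|
  x≡ : x ≡ length X
  x≡ = begin
    x                                    ≡⟨ nth-last X x ⟨
    nth (X ∷ʳ x) (suc (length X))        ≡⟨ cong (nth (X ∷ʳ x)) vrect≡ ⟨
    nth (X ∷ʳ x) (vrect (X ∷ʳ x))        ≡⟨ corner ⟩
    vrect (X ∷ʳ x) ∸ 1                   ≡⟨ cong (_∸ 1) vrect≡ ⟩
    length X                             ∎

∷ʳ-square : ∀ X → Sorted (X ∷ʳ length X) → All (0 <_) (X ∷ʳ length X) → IsSquare X []
∷ʳ-square X ρ↓ ρ>0 =
  isSquare (proj₂ (Allₚ.∷ʳ⁻ ρ>0)) (proj₁ (Sorted-++⁻ X ρ↓))
           (Allₚ.++⁻ˡ X (subst (λ n → All (n ≤_) (X ∷ʳ length X)) last≡ (Sorted-last (X ∷ʳ length X) ρ↓))) []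
  where
  last≡ : nth (X ∷ʳ length X) (length (X ∷ʳ length X)) ≡ length X
  last≡ = trans (cong (nth (X ∷ʳ length X)) (length-∷ʳ X (length X))) (nth-last X (length X))

-- Injectivity

lowered-nonempty : ∀ pre B post → ¬ lowered pre B post ≡ []
lowered-nonempty pre B post = stack-nonempty pre (λ eq → case ++-conicalʳ (map pred B) _ eq of λ ())

sq-lowered-[] : ∀ {B post} → Marked [] B post → sq (lowered [] B post) ≡ length (map pred B)
sq-lowered-[] m = sq-square (Lowering.lowered-square m)

sq-lowered-∷ : ∀ {D pre B post} → Marked (D ∷ pre) B post → sq (lowered (D ∷ pre) B post) ≡ length D
sq-lowered-∷ m = sq-square (Squares-head (Lowering.lowered-squares m))

-- Separates marked decompositions of different lengths of pre in the injectivity proof.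
lowered≢shift : ∀ {pre B post d post′} → Marked pre B post → All (_≤ d) (source pre B post) →
  Squares post′ [] → All Tight post′ → All (_≤ d) (stack post′ []) → ¬ lowered pre B post ≡ d ∷ stack post′ []
lowered≢shift {[]} {[]} (marked (isSquare () _ _ _ ∷ _) _ _) _ _ _ _ _
lowered≢shift {[]} {zero ∷ _} m _ _ _ _ _ with Lowering.B-above m
... | () ∷ _
lowered≢shift {[]} {suc b ∷ _} _ (b<d ∷ _) _ _ _ eq = 1+n≰n (subst (λ n → suc n ≤ _) (∷-injectiveˡ eq) b<d)
lowered≢shift {[] ∷ _} (marked (isSquare () _ _ _ ∷ _) _ _) _ _ _ _ _
lowered≢shift {(e ∷ E) ∷ pre} {B} {post} _ _ [] _ _ eq = lowered-nonempty pre B post (++-conicalʳ E _ (∷-injectiveʳ eq))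
lowered≢shift {E@(_ ∷ _) ∷ pre} {B} {post} {d} {C ∷ post′} m@(marked (isSquare _ _ _ source≤|E| ∷ _) _ _) source≤d
              (sq-C ∷ sq-post′) (tight ∷ tights) C++post′≤d eq
  with shift-tight sq-C tight (Allₚ.++⁻ˡ C C++post′≤d)
... | C′ , refl , sq-shifted@(isSquare _ _ _ (_ ∷ post′≤c)) =
  lowered≢shift (Marked-tail m) (subst (λ n → All (_≤ n) (source pre B post)) |E|≡ source≤|E|)
                sq-post′ tights post′≤c
                (proj₂ (++-cancel-length E (d ∷ C′) |E|≡ eq′))
  where
  eq′ : lowered (E ∷ pre) B post ≡ (d ∷ C′) ++ suc (length C′) ∷ stack post′ []
  eq′ = trans eq (cong (d ∷_) (∷ʳ-++ C′ _ (stack post′ [])))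
  |E|≡ : length E ≡ length (d ∷ C′)
  |E|≡ = trans (sym (sq-lowered-∷ m)) (trans (cong sq eq′) (sq-square sq-shifted))

lowered-injective-mixed : ∀ {B₁ post₁ D₂ pre₂ B₂ post₂} →
  Marked [] B₁ post₁ → Marked (D₂ ∷ pre₂) B₂ post₂ →
  ¬ lowered [] B₁ post₁ ≡ lowered (D₂ ∷ pre₂) B₂ post₂
lowered-injective-mixed {B₁} {post₁} {D₂} {pre₂} {B₂} {post₂}
                        m₁ m₂@(marked (isSquare _ _ _ source≤|D₂| ∷ _) _ _) eq =
  lowered≢shift (Marked-tail m₂) (subst (λ n → All (_≤ n) (source pre₂ B₂ post₂)) (sym |B₁|≡) source≤|D₂|)
                (Lowering.post-squares m₁) (Marked.tight m₁) (IsSquare.below (Lowering.B-square m₁)) (sym (proj₂ split))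
  where
  split : map pred B₁ ≡ D₂ × length B₁ ∷ stack post₁ [] ≡ lowered pre₂ B₂ post₂
  split = ++-cancel-length (map pred B₁) D₂ (trans (sym (sq-lowered-[] m₁)) (trans (cong sq eq) (sq-lowered-∷ m₂))) eq
  |B₁|≡ : length B₁ ≡ length D₂
  |B₁|≡ = trans (sym (length-map pred B₁)) (cong length (proj₁ split))

lowered-injective : ∀ {pre₁ B₁ post₁ pre₂ B₂ post₂} → Marked pre₁ B₁ post₁ → Marked pre₂ B₂ post₂ →
  lowered pre₁ B₁ post₁ ≡ lowered pre₂ B₂ post₂ → source pre₁ B₁ post₁ ≡ source pre₂ B₂ post₂
lowered-injective {[]} {B₁} {post₁} {[]} {B₂} {post₂} m₁ m₂ eq =
  cong₂ _++_ (map-pred-injective (positive m₁) (positive m₂) (proj₁ split)) (∷-injectiveʳ (proj₂ split))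
  where
  split : map pred B₁ ≡ map pred B₂ × length B₁ ∷ stack post₁ [] ≡ length B₂ ∷ stack post₂ []
  split = ++-cancel-length (map pred B₁) (map pred B₂)
            (trans (sym (sq-lowered-[] m₁)) (trans (cong sq eq) (sq-lowered-[] m₂))) eq
  positive : ∀ {B post} → Marked [] B post → All (0 <_) B
  positive m = All.map (≤-trans (s≤s z≤n)) (Lowering.B-above m)
lowered-injective {D₁ ∷ pre₁} {B₁} {post₁} {D₂ ∷ pre₂} {B₂} {post₂} m₁ m₂ eq =
  cong₂ _++_ (proj₁ split) (lowered-injective (Marked-tail m₁) (Marked-tail m₂) (proj₂ split))
  where
  split : D₁ ≡ D₂ × lowered pre₁ B₁ post₁ ≡ lowered pre₂ B₂ post₂
  split = ++-cancel-length D₁ D₂ (trans (sym (sq-lowered-∷ m₁)) (trans (cong sq eq) (sq-lowered-∷ m₂))) eq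
lowered-injective {[]}         {pre₂ = _ ∷ _} m₁ m₂ eq = contradiction eq (lowered-injective-mixed m₁ m₂)
lowered-injective {_ ∷ _} {pre₂ = []}    m₁ m₂ eq = contradiction (sym eq) (lowered-injective-mixed m₂ m₁)

-- Inverting the lowering

prepend-square : ∀ {C R pre B post x xs} → IsSquare C R → Marked pre B post →
                 source pre B post ≡ x ∷ xs → x ≤ length C → Marked (C ∷ pre) B post
prepend-square {C} {_} {pre} {B} {post} sq-C m@(marked sq-bs raised tight) source≡ x≤|C| =
  marked (with-below sq-C source≤|C| ∷ sq-bs) raised tight
  where
  source≤|C| : All (_≤ length C) (source pre B post)
  source≤|C| = subst (All (_≤ length C)) (sym source≡) (Sorted-head (subst Sorted source≡ (Sorted-source m)) x≤|C|)

-- The remainder X ∷ʳ |X| is the lowering of the raised block map suc X.  Going backwards, a square C either sits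
-- on top of the current decomposition or, when the raised block B starts above |C|, C becomes the raised block
-- and B, unshifted, becomes tight.
unlower : ∀ cs X → Squares cs (X ∷ʳ length X) → IsSquare X [] →
  ∃ λ pre → ∃ λ B → ∃ λ post →
    Marked pre B post × length pre + length post ≡ length cs × lowered pre B post ≡ stack cs (X ∷ʳ length X)
unlower [] X [] sq-X = [] , map suc X , [] , marked (raise-square sq-X ∷ []) (raise-raised sq-X) [] , refl ,
  cong₂ (λ Y n → Y ∷ʳ n) (map-pred-suc X) (length-map suc X)
unlower (C ∷ cs) X (sq-C@(isSquare _ _ _ rest≤|C|) ∷ sq-cs) sq-X with unlower cs X sq-cs sq-X
... | (e ∷ E) ∷ pre , B , post , m , len , lowered≡ =
  (C ∷ (e ∷ E) ∷ pre) , B , post ,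
  prepend-square sq-C m refl (All.head (subst (All (_≤ length C)) (sym lowered≡) rest≤|C|)) ,
  cong suc len , cong (C ++_) lowered≡
... | [] ∷ _ , _ , _ , marked (isSquare () _ _ _ ∷ _) _ _ , _
... | [] , [] , _ , marked (isSquare () _ _ _ ∷ _) _ _ , _
... | [] , B@(b ∷ B′) , post , m , len , lowered≡ with b ≤? length C
...   | yes b≤|C| = C ∷ [] , B , post , prepend-square sq-C m refl b≤|C| , cong suc len , cong (C ++_) lowered≡
...   | no  b≰|C| =
  [] , map suc C , D ∷ post ,
  marked (raise-square (with-below sq-C D++post≤|C|) ∷ unshift-square B-lowered ∷ Lowering.post-squares m)
         (raise-raised sq-C) (∷ʳ-Tight (map pred B′) ∷ Marked.tight m) ,
  cong suc len , lowered≡′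
  where
  open ≡-Reasoning
  D = map pred B′ ∷ʳ suc (length (map pred B′))
  |B|≡ : length B ≡ suc (length (map pred B′))
  |B|≡ = cong suc (sym (length-map pred B′))
  B-lowered : IsSquare (pred b ∷ map pred B′) (suc (length (map pred B′)) ∷ stack post [])
  B-lowered = subst (λ n → IsSquare (map pred B) (n ∷ stack post [])) |B|≡ (Lowering.lowered-square m)
  lowered-B≡ : lowered [] B post ≡ pred b ∷ D ++ stack post []
  lowered-B≡ = trans (cong (λ n → pred b ∷ map pred B′ ++ n ∷ stack post []) |B|≡)
                       (cong (pred b ∷_) (sym (∷ʳ-++ (map pred B′) _ (stack post []))))
  lowered≤|C| : All (_≤ length C) (pred b ∷ D ++ stack post [])
  lowered≤|C| = subst (All (_≤ length C)) (trans (sym lowered≡) lowered-B≡) rest≤|C|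
  D++post≤|C| : All (_≤ length C) (D ++ stack post [])
  D++post≤|C| = All.tail lowered≤|C|
  pred-b≡ : pred b ≡ length C
  pred-b≡ = ≤-antisym (All.head lowered≤|C|) (<⇒≤pred (≰⇒> b≰|C|))
  lowered≡′ : lowered [] (map suc C) (D ∷ post) ≡ C ++ stack cs (X ∷ʳ length X)
  lowered≡′ = begin
    map pred (map suc C) ++ length (map suc C) ∷ D ++ stack post []
      ≡⟨ cong₂ (λ Y n → Y ++ n ∷ D ++ stack post []) (map-pred-suc C) (trans (length-map suc C) (sym pred-b≡)) ⟩
    C ++ pred b ∷ D ++ stack post []
      ≡⟨ cong (C ++_) (trans (sym lowered-B≡) lowered≡) ⟩
    C ++ stack cs (X ∷ʳ length X) ∎

-- The bijection

module _ (k n : ℕ) where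

  private
    r : ℕ
    r = suc (suc k)

  A-rr1-of-residual : ∀ {q} X → PartitionOf n q → residual k q ≡ X ∷ʳ length X → A-rr1 r n q
  A-rr1-of-residual X part ρ≡ =
    part , subst (λ ρ → drop (vrect ρ) ρ ≡ []) (sym ρ≡) (proj₁ (∷ʳ⇒vrect-shape X)) ,
    λ _ → subst (λ ρ → nth ρ (vrect ρ) ≡ vrect ρ ∸ 1) (sym ρ≡) (proj₂ (∷ʳ⇒vrect-shape X))

  T-fixed : ∀ {p} → residual k p ≡ [] → T r p ≡ p
  T-fixed ρ≡[] rewrite ρ≡[] = refl

  A-rr1-of-lowered : ∀ {pre B post} → Marked pre B post → length pre + length post ≡ k →
                     sum (source pre B post) ≡ n → A-rr1 r n (lowered pre B post)
  A-rr1-of-lowered {pre} {B} {post} m len sum≡n =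
    A-rr1-of-residual X ((AllPairs⇒Linked (Lowering.Sorted-lowered m) , Lowering.Positive-lowered m) ,
                         trans (Lowering.sum-lowered m) sum≡n)
                      (subst (λ j → residual j (lowered pre B post) ≡ X ∷ʳ length X) len ρ≡)
    where
    X = proj₁ (Lowering.residual-lowered m)
    ρ≡ = proj₂ (Lowering.residual-lowered m)

  decompose : ∀ {p} → A' r n p → ∃ λ pre → ∃ λ B → ∃ λ post →
    Marked pre B post × length pre + length post ≡ k × source pre B post ≡ p × T r p ≡ lowered pre B post
  decompose a' =
    let pre , B , post , m , source≡p , len = marked-of-A' k a'
    in pre , B , post , m , len , source≡p , subst (λ q → T r q ≡ lowered pre B post) source≡p (T-source k m len)

  A-rr1-of-empty : ∀ {q} → PartitionOf n q → residual k q ≡ [] → A-rr1 r n q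
  A-rr1-of-empty part ρ≡[] =
    part , subst (λ ρ → drop (vrect ρ) ρ ≡ []) (sym ρ≡[]) refl ,
    λ ρ≢[] → contradiction ρ≡[] ρ≢[]

  A-rr1-of-A' : ∀ {p} → A' r n p → A-rr1 r n (T r p)
  A-rr1-of-A' a'@((_ , sum≡n) , _) =
    let _ , _ , _ , m , len , source≡p , T≡ = decompose a'
    in subst (A-rr1 r n) (sym T≡) (A-rr1-of-lowered m len (trans (cong sum source≡p) sum≡n))

  A-rr1-of-A'' : ∀ {p} → A'' r n p → A-rr1 r n (T r p)
  A-rr1-of-A'' (inj₁ (part , ρ≡[])) = subst (A-rr1 r n) (sym (T-fixed ρ≡[])) (A-rr1-of-empty part ρ≡[])
  A-rr1-of-A'' (inj₂ a')            = A-rr1-of-A' a'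

  T-injective-mixed : ∀ {p q} → A-rm1 r n p → A' r n q → ¬ T r p ≡ T r q
  T-injective-mixed {p} (_ , ρ≡[]) a' T≡ =
    let pre , B , post , m , len , _ , T≡lowered = decompose a'
        X , ρ≡ = Lowering.residual-lowered m
    in ∷ʳ≢[] X (begin
      X ∷ʳ length X                               ≡⟨ ρ≡ ⟨
      residual (length pre + length post) (lowered pre B post)   ≡⟨ cong₂ residual len (trans (sym T≡lowered) (sym T≡)) ⟩
      residual k (T r p)                          ≡⟨ cong (residual k) (T-fixed ρ≡[]) ⟩
      residual k p                                ≡⟨ ρ≡[] ⟩
      []                                          ∎)
    where
    open ≡-Reasoning
    ∷ʳ≢[] : ∀ (X : List ℕ) {x} → ¬ X ∷ʳ x ≡ []
    ∷ʳ≢[] X eq = case ++-conicalʳ X _ eq of λ ()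

  T-injective : ∀ {p q} → A'' r n p → A'' r n q → T r p ≡ T r q → p ≡ q
  T-injective (inj₁ (_ , ρp≡[])) (inj₁ (_ , ρq≡[])) T≡ = trans (sym (T-fixed ρp≡[])) (trans T≡ (T-fixed ρq≡[]))
  T-injective (inj₁ a)           (inj₂ a')          T≡ = contradiction T≡ (T-injective-mixed a a')
  T-injective (inj₂ a')          (inj₁ a)           T≡ = contradiction (sym T≡) (T-injective-mixed a a')
  T-injective (inj₂ a'₁)         (inj₂ a'₂)         T≡ =
    let _ , _ , _ , m₁ , _ , source≡p , T≡₁ = decompose a'₁
        _ , _ , _ , m₂ , _ , source≡q , T≡₂ = decompose a'₂
    in trans (sym source≡p) (trans (lowered-injective m₁ m₂ (trans (sym T≡₁) (trans T≡ T≡₂))) source≡q)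

  preimage-nonempty : ∀ {μ} → A-rr1 r n μ → ¬ residual k μ ≡ [] → ∃ λ p → A'' r n p × T r p ≡ μ
  preimage-nonempty {μ} (((μ↓ , μ>0) , sum≡n) , dropped , corner) ρ≢[] =
    let X , ρ≡ = vrect-shape⇒∷ʳ (residual k μ) dropped (corner ρ≢[]) ρ≢[]
        cs , sq-cs , cs≡μ , |cs|≡ = squares-of k μ (Sorted⇐Linked μ↓) (sides-positive k μ μ>0 ρ≢[])
        sq-X = ∷ʳ-square X (subst Sorted ρ≡ (Sorted-residual k (Sorted⇐Linked μ↓)))
                           (subst (All (0 <_)) ρ≡ (All-residual k μ>0))
        pre , B , post , m , len , lowered≡ = unlower cs X (subst (Squares cs) ρ≡ sq-cs) sq-X
        len′ = trans len (length-from-sides k μ |cs|≡)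
        lowered≡μ = trans lowered≡ (trans (cong (stack cs) (sym ρ≡)) cs≡μ)
        sum≡n′ = trans (sym (Lowering.sum-lowered m)) (trans (cong sum lowered≡μ) sum≡n)
    in source pre B post , inj₂ (A'-source k m len′ sum≡n′) , trans (T-source k m len′) lowered≡μ

  preimage : ∀ μ → A-rr1 r n μ → ∃ λ p → A'' r n p × T r p ≡ μ
  preimage μ a@(part , _) = go (residual k μ) refl
    where
    go : ∀ ρ → residual k μ ≡ ρ → ∃ λ p → A'' r n p × T r p ≡ μ
    go []      ρ≡[] = μ , inj₁ (part , ρ≡[]) , T-fixed ρ≡[]
    go (_ ∷ _) ρ≡∷  = preimage-nonempty a (λ ρ≡[] → case trans (sym ρ≡∷) ρ≡[] of λ ())

lemma6p2 : (r n : ℕ) → 2 ≤ r →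
    ((p : List ℕ) → A'' r n p → A-rr1 r n (T r p))
    × ((p q : List ℕ) → A'' r n p → A'' r n q → T r p ≡ T r q → p ≡ q)
    × ((μ : List ℕ) → A-rr1 r n μ → ∃ (λ p → A'' r n p × T r p ≡ μ))
lemma6p2 (suc (suc k)) n _ = (λ _ → A-rr1-of-A'' k n) , (λ _ _ → T-injective k n) , preimage k n
lemma6p2 (suc zero) _ (s≤s ())
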